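{- For any $n\geq 3$, with $C_n$ the cycle of order $n$ and $W_n$ the wheel of order $n+1$: $\chi_d^t(C_n)<\chi_d^t(W_n)$ if $n\in\{3,4\}$; $\chi_d^t(C_n)=\chi_d^t(W_n)$ if $n=5$; and $\chi_d^t(C_n)>\chi_d^t(W_n)$ otherwise.
   Context: The wheel $W_n$ is obtained from the cycle $C_n$ by adding one new vertex adjacent to all vertices of the cycle. A total dominator coloring of a graph $G$ is a proper vertex coloring of $G$ in which each vertex of $G$ is adjacent to every vertex of some color class; $\chi_d^t(G)$ is the minimum number of color classes in a total dominator coloring of $G$. -}

module Defs where

open import Data.Nat using (ℕ; zero; suc; _+_; _%_; _<_; NonZero)
open import Data.Fin using (Fin; toℕ) renaming (zero to fz; suc to fs)
open import Data.Product using (Σ; ∃; _×_; _,_)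
open import Data.Sum using (_⊎_)
open import Data.Empty using (⊥)
open import Data.Unit using (⊤)
open import Relation.Binary.PropositionalEquality using (_≡_; _≢_)
open import Relation.Nullary using (¬_)
open import Function.Definitions using (Surjective)

record Graph (n : ℕ) : Set₁ where
  field
    Adj : Fin n → Fin n → Set

open Graph public

-- Cycle C_n on vertices 0..n-1: i ~ j iff j ≡ i+1 (mod n) or i ≡ j+1 (mod n).
-- (Intended for n ≥ 3, where this is the simple cycle of order n.)
CycleAdj : (n : ℕ) → .{{_ : NonZero n}} → Fin n → Fin n → Set
CycleAdj n i j = (toℕ j ≡ (toℕ i + 1) % n) ⊎ (toℕ i ≡ (toℕ j + 1) % n)

Cycle : (n : ℕ) → .{{_ : NonZero n}} → Graph n
Cycle n = record { Adj = CycleAdj n }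

-- Wheel W_n on vertices Fin (suc n): vertex fz is the hub, fs i are the cycle vertices.
WheelAdj : (n : ℕ) → .{{_ : NonZero n}} → Fin (suc n) → Fin (suc n) → Set
WheelAdj n fz     fz     = ⊥
WheelAdj n fz     (fs j) = ⊤
WheelAdj n (fs i) fz     = ⊤
WheelAdj n (fs i) (fs j) = CycleAdj n i j

Wheel : (n : ℕ) → .{{_ : NonZero n}} → Graph (suc n)
Wheel n = record { Adj = WheelAdj n }

-- A coloring with exactly k color classes: a surjective map onto Fin k
-- (surjectivity = every one of the k color classes is nonempty).
record IsTDColoring {n : ℕ} (G : Graph n) (k : ℕ) (c : Fin n → Fin k) : Set where
  field
    surjective : Surjective _≡_ _≡_ c
    proper     : ∀ u v → Adj G u v → c u ≢ c v
    dominating : ∀ v → Σ (Fin k) λ i → ∀ u → c u ≡ i → Adj G v u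

HasTDColoring : {n : ℕ} → Graph n → ℕ → Set
HasTDColoring {n} G k = Σ (Fin n → Fin k) λ c → IsTDColoring G k c

IsTDChromaticNumber : {n : ℕ} → Graph n → ℕ → Set
IsTDChromaticNumber G k = HasTDColoring G k × (∀ m → m < k → ¬ HasTDColoring G m)

module Submission where

-- Write a = χ_d^t(C_n) and b = χ_d^t(W_n).  The proof compares explicit
-- upper and lower bounds on a and b:
--
--   * TD colourings of a graph with decidable adjacency are decidable
--     (exhaustive search over all colourings), so by the least number
--     principle χ_d^t exists as soon as some TD colouring exists.
--   * Upper bounds come from colourings: the identity colouring of C_n
--     (a ≤ n), a 4-colouring of every wheel (b ≤ 4), and small explicit
--     colourings of C_4, C_5 and W_6.
--   * Lower bounds for the small wheels W_3, W_4, W_5 are found by search.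
--   * The general lower bound for cycles is a counting argument: every
--     vertex dominates a class inside its two neighbours, which gives
--     2 + n ≤ 2k or 2n ≤ 3k for a TD colouring of C_n (n ≥ 5) with k
--     colours; hence a ≥ 4 for n ≥ 5 and a ≥ 5 for n ≥ 7.

open import Defs
open import Data.Nat using (ℕ; zero; suc; _+_; _*_; _∸_; _%_; _/_; _<_; _>_; _≤_; _≥_; NonZero; z≤n; s≤s; _≤?_; >-nonZero⁻¹)
open import Data.Nat.Properties
  using (≤-refl; ≤-trans; ≤-antisym; <-irrefl; <⇒≱; ≰⇒>; ≮⇒≥; n≤1+n; m≤m+n; +-comm; +-assoc; +-cancelˡ-≡; +-mono-≤; +-monoʳ-≤; *-monoˡ-≤; ≤∧≢⇒<; m+[n∸m]≡n; anyUpTo?; allUpTo?)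
  renaming (_≟_ to _≟ℕ_)
open import Data.Nat.DivMod using (m%n<n; %-distribˡ-+; m%n%n≡m%n; m<n⇒m%n≡m; n%n≡0; [m+n]%n≡m%n; m≡m%n+[m/n]*n)
open import Data.Nat.Induction using (<-rec)
open import Data.Fin using (Fin; toℕ; fromℕ<; _≟_; punchOut; combine; splitAt; join) renaming (zero to fz; suc to fs)
open import Data.Fin.Properties using (toℕ-fromℕ<; toℕ-injective; toℕ<n; any?; all?; injective⇒≤; combine-injective; punchOut-injective; join-splitAt)
open import Data.Vec.Functional using (_∷_; head; tail)
open import Data.Product using (Σ; ∃; _×_; _,_; proj₁; proj₂)
open import Data.Sum using (_⊎_; inj₁; inj₂; [_,_]′)
open import Data.Empty using (⊥-elim)
open import Data.Unit using (tt)
open import Function using (_∘_)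
open import Relation.Binary.PropositionalEquality using (_≡_; _≢_; _≗_; refl; sym; trans; cong; subst; module ≡-Reasoning)
open import Relation.Nullary using (¬_; Dec; yes; no)
open import Relation.Nullary.Decidable using (map′; _⊎-dec_; _×-dec_; _→-dec_; ¬?; from-yes; from-no)

DecidableAdj : {n : ℕ} → Graph n → Set
DecidableAdj {n} G = ∀ u v → Dec (Adj G u v)

cycleAdj? : (n : ℕ) .{{_ : NonZero n}} → DecidableAdj (Cycle n)
cycleAdj? n i j = (toℕ j ≟ℕ (toℕ i + 1) % n) ⊎-dec (toℕ i ≟ℕ (toℕ j + 1) % n)

wheelAdj? : (n : ℕ) .{{_ : NonZero n}} → DecidableAdj (Wheel n)
wheelAdj? n fz     fz     = no (λ ())
wheelAdj? n fz     (fs j) = yes tt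
wheelAdj? n (fs i) fz     = yes tt
wheelAdj? n (fs i) (fs j) = cycleAdj? n i j

isTDColoring-resp-≗ : {n k : ℕ} (G : Graph n) {c c′ : Fin n → Fin k} →
  c ≗ c′ → IsTDColoring G k c → IsTDColoring G k c′
isTDColoring-resp-≗ G {c} {c′} c≗c′ td = record
  { surjective = λ i → let (x , cx≡i) = surjective i in
      x , λ { refl → trans (sym (c≗c′ x)) (cx≡i refl) }
  ; proper     = λ u v uv c′u≡c′v → proper u v uv (trans (c≗c′ u) (trans c′u≡c′v (sym (c≗c′ v))))
  ; dominating = λ v → let (i , dom) = dominating v in
      i , λ u c′u≡i → dom u (trans (c≗c′ u) c′u≡i)
  }
  where open IsTDColoring td

-- All three conditions quantify over finitely many vertices and colours.
isTDColoring? : {n : ℕ} (G : Graph n) → DecidableAdj G →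
  (k : ℕ) (c : Fin n → Fin k) → Dec (IsTDColoring G k c)
isTDColoring? {n} G adj? k c = map′ fromChecks toChecks (surjective? ×-dec proper? ×-dec dominating?)
  where
  Surj Prop Dom : Set
  Surj = ∀ i → ∃ λ x → c x ≡ i
  Prop = ∀ u v → Adj G u v → c u ≢ c v
  Dom  = ∀ v → Σ (Fin k) λ i → ∀ u → c u ≡ i → Adj G v u

  surjective? : Dec Surj
  surjective? = all? λ i → any? λ x → c x ≟ i
  proper? : Dec Prop
  proper? = all? λ u → all? λ v → adj? u v →-dec ¬? (c u ≟ c v)
  dominating? : Dec Dom
  dominating? = all? λ v → any? λ i → all? λ u → (c u ≟ i) →-dec adj? v u

  fromChecks : Surj × Prop × Dom → IsTDColoring G k c
  fromChecks (surj , prop , dom) = record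
    { surjective = λ i → proj₁ (surj i) , λ { refl → proj₂ (surj i) }
    ; proper = prop
    ; dominating = dom }
  toChecks : IsTDColoring G k c → Surj × Prop × Dom
  toChecks td = (λ i → proj₁ (surjective i) , proj₂ (surjective i) refl) , proper , dominating
    where open IsTDColoring td

searchMaps : (n : ℕ) {k : ℕ} (P : (Fin n → Fin k) → Set) → (∀ c → Dec (P c)) →
  (∀ {c c′} → c ≗ c′ → P c → P c′) → Dec (∃ P)
searchMaps zero {k} P P? resp = map′ (λ p → empty , p) (λ (c , p) → resp {c} (λ ()) p) (P? empty)
  where
  empty : Fin 0 → Fin k
  empty ()
searchMaps (suc n) P P? resp = map′
  (λ (x , c , p) → x ∷ c , p)
  (λ (c , p) → head c , tail c , resp (λ { fz → refl ; (fs i) → refl }) p)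
  (any? λ x → searchMaps n (λ c → P (x ∷ c)) (λ c → P? (x ∷ c))
                (λ c≗c′ → resp λ { fz → refl ; (fs i) → c≗c′ i }))

hasTDColoring? : {n : ℕ} (G : Graph n) → DecidableAdj G → (k : ℕ) → Dec (HasTDColoring G k)
hasTDColoring? {n} G adj? k =
  searchMaps n (IsTDColoring G k) (isTDColoring? G adj? k) (isTDColoring-resp-≗ G)

least : {P : ℕ → Set} → (∀ m → Dec (P m)) → ∀ {k} → P k →
  ∃ λ a → P a × (∀ m → m < a → ¬ P m)
least {P} P? {k} = <-rec Goal step k
  where
  Goal : ℕ → Set
  Goal k = P k → ∃ λ a → P a × (∀ m → m < a → ¬ P m)
  step : ∀ k → (∀ {m} → m < k → Goal m) → Goal k
  step k smaller pk with anyUpTo? P? k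
  ... | yes (m , m<k , pm) = smaller m<k pm
  ... | no none            = k , pk , λ m m<k pm → none (m , m<k , pm)

tdChromaticNumber : {n k : ℕ} (G : Graph n) → DecidableAdj G → HasTDColoring G k →
  ∃ (IsTDChromaticNumber G)
tdChromaticNumber G adj? = least (hasTDColoring? G adj?)

noneBelow⇒≤ : {P : ℕ → Set} {k m : ℕ} → (∀ {j} → j < k → ¬ P j) → P m → k ≤ m
noneBelow⇒≤ none pm = ≮⇒≥ λ m<k → none m<k pm

χ≤ : {n a k : ℕ} {G : Graph n} → IsTDChromaticNumber G a → HasTDColoring G k → a ≤ k
χ≤ (_ , minimal) = noneBelow⇒≤ λ {j} → minimal j

binning-bound : {m a b : ℕ} (f : Fin m → Fin a) (s : Fin a → Fin m → Fin b) →
  (∀ i {x y} → f x ≡ i → f y ≡ i → s i x ≡ s i y → x ≡ y) → m ≤ a * b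
binning-bound {m} {a} {b} f s separates = injective⇒≤ code-injective
  where
  code : Fin m → Fin (a * b)
  code x = combine (f x) (s (f x) x)
  code-injective : ∀ {x y} → code x ≡ code y → x ≡ y
  code-injective {x} {y} eq with combine-injective (f x) _ (f y) _ eq
  ... | fx≡fy , sx≡sy =
    separates (f y) fx≡fy refl (subst (λ i → s i x ≡ s (f y) y) fx≡fy sx≡sy)

binning-bound-gap : {m a b : ℕ} (f : Fin m → Fin a) (s : Fin a → Fin m → Fin b) →
  (∀ i {x y} → f x ≡ i → f y ≡ i → s i x ≡ s i y → x ≡ y) →
  (j : Fin a) → (∀ x → f x ≢ j) → b + m ≤ a * b
binning-bound-gap {a = zero}  f s separates () empty
binning-bound-gap {m} {suc a} {b} f s separates j empty =
  +-monoʳ-≤ b (binning-bound f′ (λ _ x → s (f x) x) separates′)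
  where
  f′ : Fin m → Fin a
  f′ x = punchOut {i = j} (empty x ∘ sym)
  separates′ : ∀ i {x y} → f′ x ≡ i → f′ y ≡ i → s (f x) x ≡ s (f y) y → x ≡ y
  separates′ i {x} {y} refl f′y≡f′x sx≡sy =
    separates (f y) fx≡fy refl (subst (λ i → s i x ≡ s (f y) y) fx≡fy sx≡sy)
    where
    fx≡fy : f x ≡ f y
    fx≡fy = punchOut-injective (empty x ∘ sym) (empty y ∘ sym) (sym f′y≡f′x)

binning-bound-⊎ : {m m′ a b : ℕ} (f : Fin m ⊎ Fin m′ → Fin a) (s : Fin a → Fin m ⊎ Fin m′ → Fin b) →
  (∀ i {x y} → f x ≡ i → f y ≡ i → s i x ≡ s i y → x ≡ y) → m + m′ ≤ a * b
binning-bound-⊎ {m} {m′} f s separates =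
  binning-bound (f ∘ splitAt m) (λ i → s i ∘ splitAt m) λ i {x} {y} fx fy sxy →
    trans (sym (join-splitAt m m′ x))
          (trans (cong (join m m′) (separates i fx fy sxy)) (join-splitAt m m′ y))

module CycleOrder (N : ℕ) .{{_ : NonZero N}} where
  open ≡-Reasoning

  next : Fin N → Fin N
  next x = fromℕ< (m%n<n (toℕ x + 1) N)

  toℕ-next : ∀ x → toℕ (next x) ≡ (toℕ x + 1) % N
  toℕ-next x = toℕ-fromℕ< (m%n<n (toℕ x + 1) N)

  next-cases : ∀ x → toℕ (next x) ≡ suc (toℕ x) ⊎ (suc (toℕ x) ≡ N × toℕ (next x) ≡ 0)
  next-cases x with suc (toℕ x) ≟ℕ N
  ... | yes last = inj₂ (last , (begin
    toℕ (next x)        ≡⟨ toℕ-next x ⟩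
    (toℕ x + 1) % N     ≡⟨ cong (_% N) (trans (+-comm (toℕ x) 1) last) ⟩
    N % N               ≡⟨ n%n≡0 N ⟩
    0                   ∎))
  ... | no ¬last = inj₁ (begin
    toℕ (next x)        ≡⟨ toℕ-next x ⟩
    (toℕ x + 1) % N     ≡⟨ cong (_% N) (+-comm (toℕ x) 1) ⟩
    suc (toℕ x) % N     ≡⟨ m<n⇒m%n≡m (≤∧≢⇒< (toℕ<n x) ¬last) ⟩
    suc (toℕ x)         ∎)

  next^ : ℕ → Fin N → Fin N
  next^ zero    x = x
  next^ (suc j) x = next (next^ j x)

  %-absorbˡ : ∀ a j → (a % N + j) % N ≡ (a + j) % N
  %-absorbˡ a j = begin
    (a % N + j) % N            ≡⟨ %-distribˡ-+ (a % N) j N ⟩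
    (a % N % N + j % N) % N    ≡⟨ cong (λ z → (z + j % N) % N) (m%n%n≡m%n a N) ⟩
    (a % N + j % N) % N        ≡⟨ %-distribˡ-+ a j N ⟨
    (a + j) % N                ∎

  toℕ-next^ : ∀ j x → toℕ (next^ j x) ≡ (toℕ x + j) % N
  toℕ-next^ zero    x = trans (sym (m<n⇒m%n≡m (toℕ<n x))) (cong (_% N) (+-comm 0 (toℕ x)))
  toℕ-next^ (suc j) x = begin
    toℕ (next (next^ j x))         ≡⟨ toℕ-next (next^ j x) ⟩
    (toℕ (next^ j x) + 1) % N      ≡⟨ cong (λ z → (z + 1) % N) (toℕ-next^ j x) ⟩
    ((toℕ x + j) % N + 1) % N      ≡⟨ %-absorbˡ (toℕ x + j) 1 ⟩
    (toℕ x + j + 1) % N            ≡⟨ cong (_% N) (trans (+-assoc (toℕ x) j 1) (cong (toℕ x +_) (+-comm j 1))) ⟩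
    (toℕ x + suc j) % N            ∎

  no-multiple-below : ∀ {j} q → 0 < j → j < N → j ≢ q * N
  no-multiple-below zero    0<j _   refl = <-irrefl refl 0<j
  no-multiple-below (suc q) _   j<N refl = <⇒≱ j<N (m≤m+n N (q * N))

  next^-moves : ∀ {j} x → 0 < j → j < N → next^ j x ≢ x
  next^-moves {j} x 0<j j<N returns = no-multiple-below q 0<j j<N (+-cancelˡ-≡ (toℕ x) j (q * N) (begin
    toℕ x + j                  ≡⟨ m≡m%n+[m/n]*n (toℕ x + j) N ⟩
    (toℕ x + j) % N + q * N    ≡⟨ cong (_+ q * N) (trans (sym (toℕ-next^ j x)) (cong toℕ returns)) ⟩
    toℕ x + q * N              ∎))
    where
    q : ℕ
    q = (toℕ x + j) / N

  -- N - 1 further steps undo a step.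
  next-injective : ∀ {x y} → next x ≡ next y → x ≡ y
  next-injective {x} {y} eq =
    toℕ-injective (trans (sym (back x)) (trans (cong (toℕ ∘ next^ (N ∸ 1)) eq) (back y)))
    where
    back : ∀ x → toℕ (next^ (N ∸ 1) (next x)) ≡ toℕ x
    back x = begin
      toℕ (next^ (N ∸ 1) (next x))        ≡⟨ toℕ-next^ (N ∸ 1) (next x) ⟩
      (toℕ (next x) + (N ∸ 1)) % N        ≡⟨ cong (λ z → (z + (N ∸ 1)) % N) (toℕ-next x) ⟩
      ((toℕ x + 1) % N + (N ∸ 1)) % N     ≡⟨ %-absorbˡ (toℕ x + 1) (N ∸ 1) ⟩
      (toℕ x + 1 + (N ∸ 1)) % N           ≡⟨ cong (_% N) (+-assoc (toℕ x) 1 (N ∸ 1)) ⟩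
      (toℕ x + (1 + (N ∸ 1))) % N         ≡⟨ cong (λ z → (toℕ x + z) % N) (m+[n∸m]≡n (>-nonZero⁻¹ N)) ⟩
      (toℕ x + N) % N                     ≡⟨ [m+n]%n≡m%n (toℕ x) N ⟩
      toℕ x % N                           ≡⟨ m<n⇒m%n≡m (toℕ<n x) ⟩
      toℕ x                               ∎

  infix 4 _~_
  _~_ : Fin N → Fin N → Set
  x ~ y = y ≡ next x ⊎ x ≡ next y

  ~-sym : ∀ {x y} → x ~ y → y ~ x
  ~-sym (inj₁ e) = inj₂ e
  ~-sym (inj₂ e) = inj₁ e

  adjacent⇒~ : ∀ {x y} → CycleAdj N x y → x ~ y
  adjacent⇒~ {x} {y} (inj₁ e) = inj₁ (toℕ-injective (trans e (sym (toℕ-next x))))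
  adjacent⇒~ {x} {y} (inj₂ e) = inj₂ (toℕ-injective (trans e (sym (toℕ-next y))))

  next-adjacent : ∀ x → CycleAdj N x (next x)
  next-adjacent x = inj₁ (toℕ-next x)

  three-neighbours : ∀ {w x y z} → w ~ x → w ~ y → w ~ z → x ≡ y ⊎ x ≡ z ⊎ y ≡ z
  three-neighbours (inj₁ x≡) (inj₁ y≡) _         = inj₁ (trans x≡ (sym y≡))
  three-neighbours (inj₂ w≡) (inj₂ w≡′) _        = inj₁ (next-injective (trans (sym w≡) w≡′))
  three-neighbours (inj₁ x≡) (inj₂ _)  (inj₁ z≡) = inj₂ (inj₁ (trans x≡ (sym z≡)))
  three-neighbours (inj₁ _)  (inj₂ w≡) (inj₂ w≡′) = inj₂ (inj₂ (next-injective (trans (sym w≡) w≡′)))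
  three-neighbours (inj₂ w≡) (inj₁ _)  (inj₂ w≡′) = inj₂ (inj₁ (next-injective (trans (sym w≡) w≡′)))
  three-neighbours (inj₂ _)  (inj₁ y≡) (inj₁ z≡) = inj₂ (inj₂ (trans y≡ (sym z≡)))

  bySide : {A : Set} → A → A → Fin N → Fin N → A
  bySide a b r x with x ≟ next r
  ... | yes _ = a
  ... | no _  = b

  bySide-view : {A : Set} (a b : A) {r x : Fin N} → r ~ x →
    (x ≡ next r × bySide a b r x ≡ a) ⊎ (r ≡ next x × bySide a b r x ≡ b)
  bySide-view a b {r} {x} r~x with x ≟ next r | r~x
  ... | yes x≡ | _        = inj₁ (x≡ , refl)
  ... | no x≢  | inj₁ x≡  = ⊥-elim (x≢ x≡)
  ... | no _   | inj₂ r≡  = inj₂ (r≡ , refl)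

  bySide-separates : {A : Set} {a b : A} → a ≢ b → ∀ {r x y} → r ~ x → r ~ y →
    bySide a b r x ≡ bySide a b r y → x ≡ y
  bySide-separates {a = a} {b} a≢b r~x r~y eq with bySide-view a b r~x | bySide-view a b r~y
  ... | inj₁ (x≡ , _)   | inj₁ (y≡ , _)   = trans x≡ (sym y≡)
  ... | inj₂ (r≡ , _)   | inj₂ (r≡′ , _)  = next-injective (trans (sym r≡) r≡′)
  ... | inj₁ (_ , sx)   | inj₂ (_ , sy)   = ⊥-elim (a≢b (trans (sym sx) (trans eq sy)))
  ... | inj₂ (_ , sx)   | inj₁ (_ , sy)   = ⊥-elim (a≢b (trans (sym sy) (trans (sym eq) sx)))

-- Positions of vertices around a reference vertex r, used as labels.
Slot : Set
Slot = Fin 3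

pattern before = fz
pattern centre = fs fz
pattern after  = fs (fs fz)

module CycleSlots (N : ℕ) .{{_ : NonZero N}} (5≤N : 5 ≤ N) where
  open CycleOrder N

  two-moves : ∀ x → next (next x) ≢ x
  two-moves x = next^-moves {2} x (s≤s z≤n) (≤-trans (s≤s (s≤s (s≤s z≤n))) 5≤N)

  four-moves : ∀ x → next (next (next (next x))) ≢ x
  four-moves x = next^-moves {4} x (s≤s z≤n) 5≤N

  -- Label of a neighbour x of r (a dominator of the colour of r):
  -- `after` if x follows r, `before` if it precedes r.
  dominatorSlot : Fin N → Fin N → Slot
  dominatorSlot = bySide after before

  -- Label of a vertex u of the same colour as r: `centre` for r itself,
  -- `before` for the vertex two steps after r (a dominator of that colour
  -- then cannot precede r), and `after` otherwise.
  memberSlot : Fin N → Fin N → Slot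
  memberSlot r u with u ≟ r
  ... | yes _ = centre
  ... | no _ with u ≟ next (next r)
  ...   | yes _ = before
  ...   | no _  = after

  memberSlot-centre : ∀ r → memberSlot r r ≡ centre
  memberSlot-centre r with r ≟ r
  ... | yes _  = refl
  ... | no r≢r = ⊥-elim (r≢r refl)

  memberSlot≡centre : ∀ {r u} → memberSlot r u ≡ centre → u ≡ r
  memberSlot≡centre {r} {u} eq with u ≟ r
  ... | yes u≡r = u≡r
  ... | no _ with u ≟ next (next r)
  memberSlot≡centre () | no _ | yes _
  memberSlot≡centre () | no _ | no _

  memberSlot≡before : ∀ {r u} → memberSlot r u ≡ before → u ≡ next (next r)
  memberSlot≡before {r} {u} eq with u ≟ r
  memberSlot≡before () | yes _
  ... | no _ with u ≟ next (next r)
  ...   | yes u≡ = u≡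
  memberSlot≡before () | no _ | no _

  memberSlot≡after : ∀ {r u} → memberSlot r u ≡ after → u ≢ r × u ≢ next (next r)
  memberSlot≡after {r} {u} eq with u ≟ r
  memberSlot≡after () | yes _
  ... | no u≢r with u ≟ next (next r)
  memberSlot≡after () | no _ | yes _
  ...   | no u≢ = u≢r , u≢

  -- Members of one colour lie around a common vertex w; with r among them,
  -- the centre label singles out r and the others coincide.
  memberSlot-separates : ∀ {w r u v} → w ~ r → w ~ u → w ~ v →
    memberSlot r u ≡ memberSlot r v → u ≡ v
  memberSlot-separates {r = r} {u} {v} w~r w~u w~v eq with three-neighbours w~u w~v w~r
  ... | inj₁ u≡v        = u≡v
  ... | inj₂ (inj₁ refl) = sym (memberSlot≡centre (trans (sym eq) (memberSlot-centre u)))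
  ... | inj₂ (inj₂ refl) = memberSlot≡centre (trans eq (memberSlot-centre v))

  -- A common neighbour x of r and u (a dominator of their colour) never
  -- gets the same label as u.  This is where N ≥ 5 is needed.
  dominator-member-apart : ∀ {r x u} → r ~ x → x ~ u → dominatorSlot r x ≢ memberSlot r u
  dominator-member-apart {r} {x} {u} r~x x~u eq with bySide-view after before r~x
  ... | inj₁ (refl , slot) with memberSlot≡after {r} {u} (trans (sym eq) slot)
  ...   | u≢r , u≢nnr with x~u
  ...     | inj₁ u≡ = u≢nnr u≡
  ...     | inj₂ x≡ = u≢r (sym (next-injective x≡))
  dominator-member-apart {r} {x} {u} r~x x~u eq | inj₂ (r≡ , slot)
    with memberSlot≡before {r} {u} (trans (sym eq) slot) | x~u
  ... | u≡ | inj₁ u≡′ = two-moves r (sym (trans r≡ (trans (sym u≡′) u≡)))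
  ... | u≡ | inj₂ x≡  = four-moves r (sym (trans r≡ (cong next (trans x≡ (cong next u≡)))))

module CycleCount (N : ℕ) .{{_ : NonZero N}} (5≤N : 5 ≤ N)
                  {k : ℕ} (c : Fin N → Fin k) (td : IsTDColoring (Cycle N) k c) where
  open CycleOrder N
  open CycleSlots N 5≤N
  open IsTDColoring td

  dominated : Fin N → Fin k
  dominated v = proj₁ (dominating v)

  dominated-near : ∀ v {u} → c u ≡ dominated v → v ~ u
  dominated-near v {u} cu≡ = adjacent⇒~ (proj₂ (dominating v) u cu≡)

  rep : Fin k → Fin N
  rep i = proj₁ (surjective i)

  c-rep : ∀ i → c (rep i) ≡ i
  c-rep i = proj₂ (surjective i) refl

  dominator-near-rep : ∀ {x i} → dominated x ≡ i → rep i ~ x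
  dominator-near-rep {x} {i} refl = ~-sym (dominated-near x (c-rep (dominated x)))

  -- If some colour is dominated by nobody, the dominators fill k - 1
  -- colours, with at most two per colour.
  unused-colour-bound : (j : Fin k) → (∀ v → dominated v ≢ j) → 2 + N ≤ k * 2
  unused-colour-bound = binning-bound-gap dominated side separates
    where
    side : Fin k → Fin N → Fin 2
    side i = bySide (fs fz) fz (rep i)
    separates : ∀ i {x y} → dominated x ≡ i → dominated y ≡ i → side i x ≡ side i y → x ≡ y
    separates i dx dy = bySide-separates (λ ()) (dominator-near-rep dx) (dominator-near-rep dy)

  -- If every colour is dominated, each colour carries at most three
  -- vertices counting its dominators and its members together.
  all-colours-bound : (w : Fin k → Fin N) → (∀ i → dominated (w i) ≡ i) → N + N ≤ k * 3
  all-colours-bound w dominates = binning-bound-⊎ colour slot separates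
    where
    colour : Fin N ⊎ Fin N → Fin k
    colour (inj₁ x) = dominated x
    colour (inj₂ u) = c u
    slot : Fin k → Fin N ⊎ Fin N → Slot
    slot i (inj₁ x) = dominatorSlot (rep i) x
    slot i (inj₂ u) = memberSlot (rep i) u
    member-near : ∀ {u i} → c u ≡ i → w i ~ u
    member-near {u} {i} refl = dominated-near (w (c u)) (sym (dominates (c u)))
    separates : ∀ i {p q} → colour p ≡ i → colour q ≡ i → slot i p ≡ slot i q → p ≡ q
    separates i {inj₁ x} {inj₁ y} dx dy eq =
      cong inj₁ (bySide-separates (λ ()) (dominator-near-rep dx) (dominator-near-rep dy) eq)
    separates i {inj₂ u} {inj₂ v} cu cv eq =
      cong inj₂ (memberSlot-separates (member-near (c-rep i)) (member-near cu) (member-near cv) eq)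
    separates i {inj₁ x} {inj₂ u} refl cu eq =
      ⊥-elim (dominator-member-apart (dominator-near-rep refl) (dominated-near x cu) eq)
    separates i {inj₂ u} {inj₁ x} cu refl eq =
      ⊥-elim (dominator-member-apart (dominator-near-rep refl) (dominated-near x cu) (sym eq))

  colour-count : 2 + N ≤ k * 2 ⊎ N + N ≤ k * 3
  colour-count with any? (λ j → all? (λ v → ¬? (dominated v ≟ j)))
  ... | yes (j , unused) = inj₁ (unused-colour-bound j unused)
  ... | no noneUnused    = inj₂ (all-colours-bound (λ i → proj₁ (dominator i)) (λ i → proj₂ (dominator i)))
    where
    dominator : ∀ i → ∃ λ v → dominated v ≡ i
    dominator i with any? (λ v → dominated v ≟ i)
    ... | yes found = found
    ... | no none   = ⊥-elim (noneUnused (i , λ v dv≡i → none (v , dv≡i)))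

cycle≥5-needs-4 : (N : ℕ) .{{_ : NonZero N}} → 5 ≤ N → ∀ {k} → HasTDColoring (Cycle N) k → 3 < k
cycle≥5-needs-4 N 5≤N (c , td) = ≰⇒> λ k≤3 →
  [ (λ le → from-no (7 ≤? 6) (≤-trans (+-monoʳ-≤ 2 5≤N) (≤-trans le (*-monoˡ-≤ 2 k≤3))))
  , (λ le → from-no (10 ≤? 9) (≤-trans (+-mono-≤ 5≤N 5≤N) (≤-trans le (*-monoˡ-≤ 3 k≤3))))
  ]′ (CycleCount.colour-count N 5≤N c td)

cycle≥7-needs-5 : (N : ℕ) .{{_ : NonZero N}} → 7 ≤ N → ∀ {k} → HasTDColoring (Cycle N) k → 4 < k
cycle≥7-needs-5 N 7≤N (c , td) = ≰⇒> λ k≤4 →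
  [ (λ le → from-no (9 ≤? 8) (≤-trans (+-monoʳ-≤ 2 7≤N) (≤-trans le (*-monoˡ-≤ 2 k≤4))))
  , (λ le → from-no (14 ≤? 12) (≤-trans (+-mono-≤ 7≤N 7≤N) (≤-trans le (*-monoˡ-≤ 3 k≤4))))
  ]′ (CycleCount.colour-count N (≤-trans (s≤s (s≤s (s≤s (s≤s (s≤s z≤n))))) 7≤N) c td)

-- In the identity colouring every class is a single vertex, and each
-- vertex dominates the class of its successor.
identityColouring : (N : ℕ) .{{_ : NonZero N}} → 2 ≤ N → HasTDColoring (Cycle N) N
identityColouring N 2≤N = (λ x → x) , record
  { surjective = λ i → i , λ { refl → refl }
  ; proper     = λ u v uv u≡v → distinct (subst (CycleAdj N u) (sym u≡v) uv)
  ; dominating = λ v → next v , λ { _ refl → next-adjacent v }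
  }
  where
  open CycleOrder N
  distinct : ∀ {u} → ¬ CycleAdj N u u
  distinct uu with adjacent⇒~ uu
  ... | inj₁ u≡ = next^-moves {1} _ (s≤s z≤n) 2≤N (sym u≡)
  ... | inj₂ u≡ = next^-moves {1} _ (s≤s z≤n) 2≤N (sym u≡)

alternate : {k : ℕ} → ℕ → Fin (3 + k)
alternate zero          = fs fz
alternate (suc zero)    = fs (fs fz)
alternate (suc (suc a)) = alternate a

alternate-step : ∀ {k} a → alternate {k} a ≢ alternate (suc a)
alternate-step zero          ()
alternate-step (suc zero)    ()
alternate-step (suc (suc a)) = alternate-step a

alternate≢3 : ∀ a → alternate {1} a ≢ fs (fs (fs fz))
alternate≢3 zero          ()
alternate≢3 (suc zero)    ()
alternate≢3 (suc (suc a)) = alternate≢3 a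

rimColour : ℕ → Fin 4
rimColour zero    = fs (fs (fs fz))
rimColour (suc a) = alternate a

rimColour≢0 : ∀ a → rimColour a ≢ fz
rimColour≢0 zero                ()
rimColour≢0 (suc zero)          ()
rimColour≢0 (suc (suc zero))    ()
rimColour≢0 (suc (suc (suc a))) = rimColour≢0 (suc a)

rimColour-step : ∀ a → rimColour a ≢ rimColour (suc a)
rimColour-step zero    = alternate≢3 0 ∘ sym
rimColour-step (suc a) = alternate-step a

-- The wrap-around edge from the last vertex back to vertex 0.
rimColour-wrap : ∀ a → 3 ≤ suc a → rimColour a ≢ rimColour 0
rimColour-wrap zero    (s≤s ())
rimColour-wrap (suc a) _ = alternate≢3 a

-- Every wheel of order at least 3 has a TD colouring with 4 colours:
-- the hub dominates every rim vertex and the rim class 1 dominates the hub.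
wheel-4-colouring : (N : ℕ) .{{_ : NonZero N}} → 3 ≤ N → HasTDColoring (Wheel N) 4
wheel-4-colouring N 3≤N = colour , record
  { surjective = λ { fz → fz , λ { refl → refl }
                   ; (fs fz) → hits (≤-trans (s≤s (s≤s z≤n)) 3≤N)
                   ; (fs (fs fz)) → hits 3≤N
                   ; (fs (fs (fs fz))) → hits (≤-trans (s≤s z≤n) 3≤N) }
  ; proper     = proper
  ; dominating = λ { fz     → fs fz , λ { fz () ; (fs _) _ → tt }
                  ; (fs _) → fz , λ { fz _ → tt ; (fs y) e → ⊥-elim (rimColour≢0 (toℕ y) e) } }
  }
  where
  open CycleOrder N
  colour : Fin (suc N) → Fin 4
  colour fz     = fz
  colour (fs x) = rimColour (toℕ x)

  hits : ∀ {m} (m<N : m < N) → ∃ λ z → ∀ {z′} → z′ ≡ z → colour z′ ≡ rimColour m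
  hits m<N = fs (fromℕ< m<N) , λ { refl → cong rimColour (toℕ-fromℕ< m<N) }

  rim-proper : ∀ x → rimColour (toℕ x) ≢ rimColour (toℕ (next x))
  rim-proper x eq with next-cases x
  ... | inj₁ step          = rimColour-step (toℕ x) (trans eq (cong rimColour step))
  ... | inj₂ (last , wrap) =
    rimColour-wrap (toℕ x) (subst (3 ≤_) (sym last) 3≤N) (trans eq (cong rimColour wrap))

  proper : ∀ u v → WheelAdj N u v → colour u ≢ colour v
  proper fz     fz     ()
  proper fz     (fs y) _  = rimColour≢0 (toℕ y) ∘ sym
  proper (fs x) fz     _  = rimColour≢0 (toℕ x)
  proper (fs x) (fs y) xy with adjacent⇒~ xy
  ... | inj₁ refl = rim-proper x
  ... | inj₂ refl = rim-proper y ∘ sym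

cycle4-colouring : HasTDColoring (Cycle 4) 2
cycle4-colouring = colour , from-yes (isTDColoring? (Cycle 4) (cycleAdj? 4) 2 colour)
  where
  colour : Fin 4 → Fin 2
  colour fz                = fz
  colour (fs fz)           = fs fz
  colour (fs (fs fz))      = fz
  colour (fs (fs (fs fz))) = fs fz

cycle5-colouring : HasTDColoring (Cycle 5) 4
cycle5-colouring = colour , from-yes (isTDColoring? (Cycle 5) (cycleAdj? 5) 4 colour)
  where
  colour : Fin 5 → Fin 4
  colour fz                     = fz
  colour (fs fz)                = fs fz
  colour (fs (fs fz))           = fs (fs fz)
  colour (fs (fs (fs fz)))      = fs (fs (fs fz))
  colour (fs (fs (fs (fs fz)))) = fs (fs fz)

wheel6-colouring : HasTDColoring (Wheel 6) 3
wheel6-colouring = colour , from-yes (isTDColoring? (Wheel 6) (wheelAdj? 6) 3 colour)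
  where
  colour : Fin 7 → Fin 3
  colour fz     = fz
  colour (fs x) = alternate (toℕ x)

wheel-needs : (n : ℕ) .{{_ : NonZero n}} (k : ℕ) → Set
wheel-needs n k = ∀ {m} → HasTDColoring (Wheel n) m → k ≤ m

wheel-needs-by-search : (n : ℕ) .{{_ : NonZero n}} (k : ℕ) →
  Dec (∀ {m} → m < k → ¬ HasTDColoring (Wheel n) m)
wheel-needs-by-search n k = allUpTo? (λ m → ¬? (hasTDColoring? (Wheel n) (wheelAdj? n) m)) k

wheel3-needs-4 : wheel-needs 3 4
wheel3-needs-4 = noneBelow⇒≤ (from-yes (wheel-needs-by-search 3 4))

wheel4-needs-3 : wheel-needs 4 3
wheel4-needs-3 = noneBelow⇒≤ (from-yes (wheel-needs-by-search 4 3))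

wheel5-needs-4 : wheel-needs 5 4
wheel5-needs-4 = noneBelow⇒≤ (from-yes (wheel-needs-by-search 5 4))

Outcome : ℕ → ℕ → ℕ → Set
Outcome n a b = (n ≤ 4 → a < b) × (n ≡ 5 → a ≡ b) × (n ≥ 6 → a > b)

-- Only one of the three hypotheses of an outcome can hold.
outcome-small : ∀ {n a b} → n ≤ 4 → a < b → Outcome n a b
outcome-small n≤4 a<b =
    (λ _ → a<b)
  , (λ { refl → ⊥-elim (from-no (5 ≤? 4) n≤4) })
  , (λ 6≤n → ⊥-elim (from-no (6 ≤? 4) (≤-trans 6≤n n≤4)))

outcome-five : ∀ {a b} → a ≡ b → Outcome 5 a b
outcome-five a≡b = ⊥-elim ∘ from-no (5 ≤? 4) , (λ _ → a≡b) , ⊥-elim ∘ from-no (6 ≤? 5)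

outcome-large : ∀ {n a b} → n ≥ 6 → a > b → Outcome n a b
outcome-large 6≤n a>b =
    (λ n≤4 → ⊥-elim (from-no (6 ≤? 4) (≤-trans 6≤n n≤4)))
  , (λ { refl → ⊥-elim (from-no (6 ≤? 5) 6≤n) })
  , (λ _ → a>b)

comparison : (n : ℕ) .{{_ : NonZero n}} {a b : ℕ} → n ≥ 3 →
  IsTDChromaticNumber (Cycle n) a → IsTDChromaticNumber (Wheel n) b → Outcome n a b
comparison 0 ()
comparison 1 (s≤s ())
comparison 2 (s≤s (s≤s ()))
-- a ≤ 3 < b
comparison 3 _ χC χW = outcome-small (n≤1+n 3)
  (≤-trans (s≤s (χ≤ χC (identityColouring 3 (n≤1+n 2)))) (wheel3-needs-4 (proj₁ χW)))
-- a ≤ 2 < b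
comparison 4 _ χC χW = outcome-small ≤-refl
  (≤-trans (s≤s (χ≤ χC cycle4-colouring)) (wheel4-needs-3 (proj₁ χW)))
-- a ≤ 4 ≤ b and b ≤ 4 ≤ a
comparison 5 _ χC χW = outcome-five (≤-antisym
  (≤-trans (χ≤ χC cycle5-colouring) (wheel5-needs-4 (proj₁ χW)))
  (≤-trans (χ≤ χW (wheel-4-colouring 5 (s≤s (s≤s (s≤s z≤n))))) (cycle≥5-needs-4 5 ≤-refl (proj₁ χC))))
-- b ≤ 3 < a
comparison 6 _ χC χW = outcome-large ≤-refl
  (≤-trans (s≤s (χ≤ χW wheel6-colouring)) (cycle≥5-needs-4 6 (n≤1+n 5) (proj₁ χC)))
-- b ≤ 4 < a
comparison n@(suc (suc (suc (suc (suc (suc (suc m))))))) _ χC χW = outcome-large (≤-trans (n≤1+n 6) 7≤n)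
  (≤-trans (s≤s (χ≤ χW (wheel-4-colouring n (≤-trans (s≤s (s≤s (s≤s z≤n))) 7≤n))))
           (cycle≥7-needs-5 n 7≤n (proj₁ χC)))
  where
  7≤n : 7 ≤ n
  7≤n = m≤m+n 7 m

proposition5p2 : (n : ℕ) → .{{_ : NonZero n}} → n ≥ 3 →
    ∃ λ a → ∃ λ b → IsTDChromaticNumber (Cycle n) a × IsTDChromaticNumber (Wheel n) b ×
      ((n ≤ 4 → a < b) × (n ≡ 5 → a ≡ b) × (n ≥ 6 → a > b))
proposition5p2 n n≥3 =
  let (a , χC) = tdChromaticNumber (Cycle n) (cycleAdj? n) (identityColouring n (≤-trans (n≤1+n 2) n≥3))
      (b , χW) = tdChromaticNumber (Wheel n) (wheelAdj? n) (wheel-4-colouring n n≥3)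
  in  a , b , χC , χW , comparison n n≥3 χC χW
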